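{- Let $q=2^m$, let $h$ be a positive integer with $\gcd(h,m)=1$, and let $f(x)=x^{2^h}$. Then the design $\mathbf{D}(f,q/2)=(\mathrm{GF}(q),\mathcal{B}_{(f,q/2)})$ has exactly two block intersection numbers, $0$ and $q/4$ (i.e., any two distinct blocks meet in either $0$ or $q/4$ points, and both values occur); thus it is quasi-symmetric.
   Context: For a polynomial $f$ over $\mathrm{GF}(q)$ (viewed as a function $\mathrm{GF}(q)\to\mathrm{GF}(q)$), for $(b,c)\in\mathrm{GF}(q)^2$ put $B_{(f,b,c)}=\{f(x)+bx+c: x\in \mathrm{GF}(q)\}$. For an integer $k$ with $2\le k\le q$, $\mathcal{B}_{(f,k)}=\{B_{(f,b,c)}: |B_{(f,b,c)}|=k,\ b,c\in\mathrm{GF}(q)\}$ (a set, so each block appears once), and $\mathbf{D}(f,k)$ is the incidence structure with point set $\mathrm{GF}(q)$, block set $\mathcal{B}_{(f,k)}$ and incidence given by membership. A design is quasi-symmetric if the intersection of two distinct blocks takes exactly two sizes. -}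

module Defs where

open import Level using (0ℓ)
open import Data.Nat using (ℕ; zero; suc)
open import Data.Fin using (Fin)
open import Data.Fin.Properties using () renaming (_≟_ to _≟F_)
open import Data.List using (List; map; filter; length; allFin)
open import Data.List.Membership.Propositional using (_∈_)
import Data.List.Membership.DecPropositional as DecMem
open import Data.Product using (_×_; ∃)
open import Data.Unit using (⊤)
open import Data.Product using (_,_)
open import Function using (_↔_; Inverse)
open import Relation.Nullary using (¬_; Dec; yes; no)
open import Relation.Nullary.Decidable using (_×-dec_)
open import Relation.Binary using (DecidableEquality)
open import Relation.Binary.PropositionalEquality using (_≡_; refl; cong; trans; sym)
open import Algebra.Core using (Op₁; Op₂)
open import Algebra.Structures using (IsCommutativeRing)

record FiniteField : Set₁ where
  infixl 6 _+_
  infixl 7 _*_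
  field
    Carrier           : Set
    _+_ _*_           : Op₂ Carrier
    -_                : Op₁ Carrier
    0# 1#             : Carrier
    isCommutativeRing : IsCommutativeRing _≡_ _+_ _*_ -_ 0# 1#
    0≢1               : ¬ (0# ≡ 1#)
    inverse           : ∀ x → ¬ (x ≡ 0#) → ∃ λ y → x * y ≡ 1#
    size              : ℕ
    enum              : Fin size ↔ Carrier

module FF (F : FiniteField) where
  open FiniteField F public

  _≟_ : DecidableEquality Carrier
  x ≟ y with Inverse.from enum x ≟F Inverse.from enum y
  ... | yes p = yes (trans (sym (Inverse.strictlyInverseˡ enum x))
                     (trans (cong (Inverse.to enum) p) (Inverse.strictlyInverseˡ enum y)))
  ... | no ¬p = no λ e → ¬p (cong (Inverse.from enum) e)

  open DecMem _≟_ using (_∈?_)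

  elements : List Carrier
  elements = map (Inverse.to enum) (allFin size)

  pow : Carrier → ℕ → Carrier
  pow x zero    = 1#
  pow x (suc n) = x * pow x n

  -- B_(f,b,c) = { f(x) + b x + c : x ∈ GF(q) }, as a list (possibly with repetitions)
  block : (Carrier → Carrier) → Carrier → Carrier → List Carrier
  block f b c = map (λ x → f x + b * x + c) elements

  card : List Carrier → ℕ
  card B = length (filter (λ x → x ∈? B) elements)

  interSize : List Carrier → List Carrier → ℕ
  interSize B B′ = length (filter (λ x → (x ∈? B) ×-dec (x ∈? B′)) elements)

  SameSet : List Carrier → List Carrier → Set
  SameSet B B′ = ∀ x → (x ∈ B → x ∈ B′) × (x ∈ B′ → x ∈ B)

-- Put f x = x ^ (2 ^ h) and L_b x = f x + b x.  A field of order 2 ^ m has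
-- characteristic two, so f and every L_b are additive, and the block
-- B(b, c) = {L_b x + c} is the coset of the subgroup Im L_b by c.
--  * If two blocks have q/2 points they are cosets of subgroups of index two.
--    Distinct cosets of one such subgroup are disjoint; cosets of two different
--    ones always meet, in a translate of their intersection, which has q/4 points.
--  * For t ≢ 0 and b = t ^ (2 ^ h - 1) the kernel of L_b is {0, t}: a root t w
--    forces f w = w, and since also w ^ q = w (Fermat), Bézout for gcd(h, m) = 1
--    gives w * w = w.  A two-to-one additive map has an image of size q/2.
--  * B(1, 0) and B(1, y₀) with y₀ ∉ Im L_1 are disjoint, and B(1, 0) meets the
--    block B(b, 0) whose image contains y₀ in q/4 points.

module Submission where

open import Defs
open import Data.Nat using (ℕ; _≤_; _^_; _/_)
open import Data.Nat.GCD using (gcd)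
open import Data.Product using (_×_; Σ-syntax)
open import Data.Sum using (_⊎_)
open import Relation.Nullary using (¬_)
open import Relation.Binary.PropositionalEquality using (_≡_)

open import Level using (0ℓ)
import Data.Nat as ℕ
import Data.Nat.Properties as ℕₚ
open import Data.Nat.GCD using (GCD; gcd-GCD; module Bézout)
open import Data.Nat.DivMod using (m*n/n≡m)
open import Data.Unit using (⊤; tt)
open import Data.Fin using (toℕ)
open import Data.Fin.Properties using (toℕ-injective)
open import Data.List using (List; []; _∷_; map; filter; length; foldr; allFin)
open import Data.List.Properties using (length-map; length-tabulate; filter-≐; filter-all; filter-none)
open import Data.List.Membership.Propositional using (_∈_)
open import Data.List.Membership.Propositional.Properties using (∈-map⁺; ∈-map⁻; ∈-filter⁺; ∈-filter⁻; ∈-allFin)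
open import Data.List.Membership.Propositional.Properties.WithK using (unique∧set⇒bag)
import Data.List.Membership.DecPropositional as DecMembership
open import Data.List.Relation.Binary.BagAndSetEquality using (∼bag⇒↭)
open import Data.List.Relation.Binary.Permutation.Propositional using (_↭_; ↭⇒↭ₛ)
open import Data.List.Relation.Binary.Permutation.Propositional.Properties using (filter-↭; ↭-length)
import Data.List.Relation.Binary.Permutation.Setoid.Properties as PermutationProperties
open import Data.List.Relation.Unary.All as All using (All; []; _∷_)
open import Data.List.Relation.Unary.AllPairs using ([]; _∷_)
import Data.List.Relation.Unary.All.Properties as AllProperties
open import Data.List.Relation.Unary.Any using (here; there)
open import Data.List.Relation.Unary.Unique.Propositional using (Unique)
import Data.List.Relation.Unary.Unique.Propositional.Properties as Unique
open import Data.Product using (_,_; proj₁; proj₂; ∃)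
open import Data.Sum using (inj₁; inj₂; [_,_]′)
import Data.Sum as Sum
open import Data.Empty using (⊥-elim)
open import Relation.Nullary using (yes; no; ¬?)
open import Relation.Nullary.Decidable using (_×-dec_; _⊎-dec_; decidable-stable)
open import Relation.Unary using (Pred; Decidable; _≐_)
open import Relation.Binary.PropositionalEquality
  using (refl; sym; trans; cong; cong₂; subst; module ≡-Reasoning; setoid)
open import Function using (Inverse; mk⇔; _∘_)
open import Algebra.Bundles using (CommutativeRing)
import Algebra.Properties.Ring as RingProperties
import Algebra.Properties.CommutativeSemigroup as CommutativeSemigroupProperties
import Algebra.Properties.CommutativeSemiring.Exp as ExpProperties

module FilterLength {A : Set} where

  length-filter-split : ∀ {P Q : Pred A 0ℓ} (P? : Decidable P) (Q? : Decidable Q) xs →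
    length (filter P? xs) ≡
      length (filter (λ x → P? x ×-dec Q? x) xs) ℕ.+ length (filter (λ x → P? x ×-dec ¬? (Q? x)) xs)
  length-filter-split P? Q? [] = refl
  length-filter-split P? Q? (x ∷ xs) with P? x | Q? x
  ... | yes _ | yes _ = cong ℕ.suc (length-filter-split P? Q? xs)
  ... | yes _ | no _  = trans (cong ℕ.suc (length-filter-split P? Q? xs)) (sym (ℕₚ.+-suc _ _))
  ... | no _  | _     = length-filter-split P? Q? xs

  length-filter-map : ∀ {P : Pred A 0ℓ} (P? : Decidable P) (g : A → A) xs →
    length (filter P? (map g xs)) ≡ length (filter (P? ∘ g) xs)
  length-filter-map P? g [] = refl
  length-filter-map P? g (x ∷ xs) with P? (g x)
  ... | yes _ = cong ℕ.suc (length-filter-map P? g xs)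
  ... | no _  = length-filter-map P? g xs

  ∈⇒length≢0 : ∀ {x} {xs : List A} → x ∈ xs → ¬ length xs ≡ 0
  ∈⇒length≢0 (here _)  ()
  ∈⇒length≢0 (there _) ()

  length≢0⇒∈ : ∀ {xs : List A} → ¬ length xs ≡ 0 → ∃ λ x → x ∈ xs
  length≢0⇒∈ {[]}    ne = ⊥-elim (ne refl)
  length≢0⇒∈ {x ∷ _} _  = x , here refl

  unique-same-members⇒↭ : ∀ {xs ys : List A} → Unique xs → Unique ys →
    (∀ {x} → x ∈ xs → x ∈ ys) → (∀ {x} → x ∈ ys → x ∈ xs) → xs ↭ ys
  unique-same-members⇒↭ uxs uys to from = ∼bag⇒↭ (unique∧set⇒bag uxs uys (mk⇔ to from))

  unique-map-injectiveOn : ∀ (g : A → A) {xs : List A} → Unique xs →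
    (∀ {x y} → x ∈ xs → y ∈ xs → g x ≡ g y → x ≡ y) → Unique (map g xs)
  unique-map-injectiveOn g {[]} [] inj = []
  unique-map-injectiveOn g {x ∷ xs} (x∉xs ∷ uxs) inj =
    AllProperties.map⁺ (All.tabulate λ y∈ gx≡gy → All.lookup x∉xs y∈ (inj (here refl) (there y∈) gx≡gy))
    ∷ unique-map-injectiveOn g uxs (λ x∈ y∈ → inj (there x∈) (there y∈))

double-injective : ∀ {a b} → a ℕ.+ a ≡ b ℕ.+ b → a ≡ b
double-injective {a} {b} a+a≡b+b = ℕₚ.*-cancelˡ-≡ a b 2
  (trans (cong (a ℕ.+_) (ℕₚ.+-identityʳ a)) (trans a+a≡b+b (sym (cong (b ℕ.+_) (ℕₚ.+-identityʳ b)))))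

2^[2+n]≡4p : ∀ n → 2 ^ (2 ℕ.+ n) ≡ (2 ^ n ℕ.+ 2 ^ n) ℕ.+ (2 ^ n ℕ.+ 2 ^ n)
2^[2+n]≡4p n = trans (cong (2 ℕ.*_) (double (2 ^ n))) (double (2 ^ n ℕ.+ 2 ^ n))
  where
  double : ∀ x → 2 ℕ.* x ≡ x ℕ.+ x
  double x = cong (x ℕ.+_) (ℕₚ.+-identityʳ x)

half-of-2^[2+n] : ∀ n → 2 ^ (2 ℕ.+ n) / 2 ≡ 2 ^ n ℕ.+ 2 ^ n
half-of-2^[2+n] n = trans (cong (_/ 2) (ℕₚ.*-comm 2 (2 ℕ.* 2 ^ n)))
  (trans (m*n/n≡m (2 ℕ.* 2 ^ n) 2) (cong (2 ^ n ℕ.+_) (ℕₚ.+-identityʳ (2 ^ n))))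

quarter-of-2^[2+n] : ∀ n → 2 ^ (2 ℕ.+ n) / 4 ≡ 2 ^ n
quarter-of-2^[2+n] n = trans (cong (_/ 4) (trans (sym (ℕₚ.*-assoc 2 2 (2 ^ n))) (ℕₚ.*-comm 4 (2 ^ n)))) (m*n/n≡m (2 ^ n) 4)

module FieldTheory (F : FiniteField) where
  open FF F
  open DecMembership _≟_ using (_∈?_)
  open FilterLength
  open ≡-Reasoning

  ring : CommutativeRing 0ℓ 0ℓ
  ring = record { isCommutativeRing = isCommutativeRing }

  open CommutativeRing ring
    using ( +-assoc; +-comm; +-identityˡ; +-identityʳ; -‿inverseʳ
          ; *-assoc; *-comm; *-identityˡ; *-identityʳ; distribˡ; distribʳ; zeroˡ; zeroʳ
          ; *-isCommutativeMonoid; commutativeSemiring; +-commutativeSemigroup; *-commutativeSemigroup )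
  open RingProperties (CommutativeRing.ring ring) using (-‿involutive; -0#≈0#)
  open CommutativeSemigroupProperties +-commutativeSemigroup using (interchange)
  open CommutativeSemigroupProperties *-commutativeSemigroup using () renaming (interchange to *-interchange)
  open ExpProperties commutativeSemiring using (^-assocʳ; ^-distrib-*)
    renaming (_^_ to _^ᶠ_)

  *-cancelˡ : ∀ a {x y} → ¬ a ≡ 0# → a * x ≡ a * y → x ≡ y
  *-cancelˡ a {x} {y} a≢0 ax≡ay with inverse a a≢0
  ... | a⁻¹ , aa⁻¹≡1 = begin
    x              ≡⟨ sym (*-identityˡ x) ⟩
    1# * x         ≡⟨ cong (_* x) (trans (sym aa⁻¹≡1) (*-comm a a⁻¹)) ⟩
    (a⁻¹ * a) * x  ≡⟨ *-assoc a⁻¹ a x ⟩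
    a⁻¹ * (a * x)  ≡⟨ cong (a⁻¹ *_) ax≡ay ⟩
    a⁻¹ * (a * y)  ≡⟨ sym (*-assoc a⁻¹ a y) ⟩
    (a⁻¹ * a) * y  ≡⟨ cong (_* y) (trans (*-comm a⁻¹ a) aa⁻¹≡1) ⟩
    1# * y         ≡⟨ *-identityˡ y ⟩
    y              ∎

  no-zero-divisors : ∀ x y → x * y ≡ 0# → x ≡ 0# ⊎ y ≡ 0#
  no-zero-divisors x y xy≡0 with x ≟ 0#
  ... | yes x≡0 = inj₁ x≡0
  ... | no  x≢0 = inj₂ (*-cancelˡ x x≢0 (trans xy≡0 (sym (zeroʳ x))))

  pow≡^ : ∀ x n → pow x n ≡ x ^ᶠ n
  pow≡^ x ℕ.zero    = refl
  pow≡^ x (ℕ.suc n) = cong (x *_) (pow≡^ x n)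

  pow-* : ∀ x a b → pow x (a ℕ.* b) ≡ pow (pow x a) b
  pow-* x a b rewrite pow≡^ x (a ℕ.* b) | pow≡^ (pow x a) b | pow≡^ x a = sym (^-assocʳ x a b)

  pow-distrib : ∀ x y n → pow (x * y) n ≡ pow x n * pow y n
  pow-distrib x y n rewrite pow≡^ (x * y) n | pow≡^ x n | pow≡^ y n = ^-distrib-* x y n

  pow-nonzero : ∀ x n → ¬ x ≡ 0# → ¬ pow x n ≡ 0#
  pow-nonzero x ℕ.zero    x≢0 1≡0 = 0≢1 (sym 1≡0)
  pow-nonzero x (ℕ.suc n) x≢0 p≡0 with no-zero-divisors x (pow x n) p≡0
  ... | inj₁ x≡0 = x≢0 x≡0
  ... | inj₂ q≡0 = pow-nonzero x n x≢0 q≡0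

  pow-one : ∀ n → pow 1# n ≡ 1#
  pow-one ℕ.zero    = refl
  pow-one (ℕ.suc n) = trans (*-identityˡ _) (pow-one n)

  count : {P : Pred Carrier 0ℓ} → Decidable P → ℕ
  count P? = length (filter P? elements)

  -- The position of an element in the enumeration; it breaks symmetries below.
  index : Carrier → ℕ
  index x = toℕ (Inverse.from enum x)

  index-injective : ∀ {x y} → index x ≡ index y → x ≡ y
  index-injective {x} {y} eq = trans (sym (Inverse.strictlyInverseˡ enum x))
    (trans (cong (Inverse.to enum) (toℕ-injective eq)) (Inverse.strictlyInverseˡ enum y))

  ∈-elements : ∀ x → x ∈ elements
  ∈-elements x = subst (_∈ elements) (Inverse.strictlyInverseˡ enum x)
                   (∈-map⁺ (Inverse.to enum) (∈-allFin (Inverse.from enum x)))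

  elements-unique : Unique elements
  elements-unique = Unique.map⁺ to-injective (Unique.allFin⁺ size)
    where
    to-injective : ∀ {i j} → Inverse.to enum i ≡ Inverse.to enum j → i ≡ j
    to-injective {i} {j} eq = trans (sym (Inverse.strictlyInverseʳ enum i))
      (trans (cong (Inverse.from enum) eq) (Inverse.strictlyInverseʳ enum j))

  length-elements : length elements ≡ size
  length-elements = trans (length-map (Inverse.to enum) (allFin size)) (length-tabulate (λ i → i))

  size-nonzero : ¬ size ≡ 0
  size-nonzero size≡0 = ∈⇒length≢0 (∈-elements 0#) (trans length-elements size≡0)

  ↭-elements : ∀ {xs} → Unique xs → (∀ x → x ∈ xs) → xs ↭ elements
  ↭-elements uxs all = unique-same-members⇒↭ uxs elements-unique (λ {x} _ → ∈-elements x) (λ {x} _ → all x)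

  module _ {P Q : Pred Carrier 0ℓ} (P? : Decidable P) (Q? : Decidable Q) where

    count-cong : P ≐ Q → count P? ≡ count Q?
    count-cong P≐Q = cong length (filter-≐ P? Q? P≐Q elements)

    count-split : count P? ≡ count (λ x → P? x ×-dec Q? x) ℕ.+ count (λ x → P? x ×-dec ¬? (Q? x))
    count-split = length-filter-split P? Q? elements

  module _ {P : Pred Carrier 0ℓ} (P? : Decidable P) where

    count-all : (∀ x → P x) → count P? ≡ size
    count-all all = trans (cong length (filter-all P? {xs = elements} (All.tabulate λ {x} _ → all x)))
                          length-elements

    count-none : (∀ x → ¬ P x) → count P? ≡ 0
    count-none none = cong length (filter-none P? {xs = elements} (All.tabulate λ {x} _ → none x))

    count-zero : count P? ≡ 0 → ∀ x → ¬ P x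
    count-zero c≡0 x px = ∈⇒length≢0 (∈-filter⁺ P? (∈-elements x) px) c≡0

    count-witness : ¬ count P? ≡ 0 → ∃ P
    count-witness c≢0 with length≢0⇒∈ c≢0
    ... | x , x∈ = x , proj₂ (∈-filter⁻ P? {xs = elements} x∈)

    count-involution : (g : Carrier → Carrier) → (∀ x → g (g x) ≡ x) → count (P? ∘ g) ≡ count P?
    count-involution g gg≡id = begin
      count (P? ∘ g)                  ≡⟨ sym (length-filter-map P? g elements) ⟩
      length (filter P? (map g elements)) ≡⟨ ↭-length (filter-↭ P? (↭-elements unique-image all-in-image)) ⟩
      count P?                        ∎
      where
      unique-image : Unique (map g elements)
      unique-image = Unique.map⁺ (λ {x} {y} gx≡gy → trans (sym (gg≡id x)) (trans (cong g gx≡gy) (gg≡id y)))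
                       elements-unique
      all-in-image : ∀ x → x ∈ map g elements
      all-in-image x = subst (_∈ map g elements) (gg≡id x) (∈-map⁺ g (∈-elements (g x)))

  module _ {P : Pred Carrier 0ℓ} (P? : Decidable P) where

    count-complement : count P? ℕ.+ count (¬? ∘ P?) ≡ size
    count-complement = begin
      count P? ℕ.+ count (¬? ∘ P?)
        ≡⟨ cong₂ ℕ._+_ (count-cong P? (λ x → ⊤? x ×-dec P? x) ((λ p → tt , p) , proj₂))
                      (count-cong (¬? ∘ P?) (λ x → ⊤? x ×-dec ¬? (P? x)) ((λ p → tt , p) , proj₂)) ⟩
      count (λ x → ⊤? x ×-dec P? x) ℕ.+ count (λ x → ⊤? x ×-dec ¬? (P? x))
        ≡⟨ sym (count-split ⊤? P?) ⟩
      count ⊤?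
        ≡⟨ count-all ⊤? (λ _ → tt) ⟩
      size ∎
      where
      ⊤? : Decidable {A = Carrier} (λ _ → ⊤)
      ⊤? _ = yes tt

  count-single : ∀ a → count (_≟ a) ≡ 1
  count-single a = ↭-length (unique-same-members⇒↭ (Unique.filter⁺ (_≟ a) elements-unique) ([] ∷ [])
    (λ x∈ → here (proj₂ (∈-filter⁻ (_≟ a) {xs = elements} x∈)))
    (λ { (here refl) → ∈-filter⁺ (_≟ a) (∈-elements a) refl }))

  -- Pairing argument: a fixed-point-free involution g preserving R splits R into
  -- pairs {x, g x}; the members with index x < index (g x) pick one from each pair,
  -- so they are exactly half of R.
  module Pairing {R : Pred Carrier 0ℓ} (R? : Decidable R) (g : Carrier → Carrier)
                 (g-involutive : ∀ x → g (g x) ≡ x) (g-preserves : ∀ x → R x → R (g x))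
                 (g-no-fixed-point : ∀ x → R x → ¬ g x ≡ x) where

    First : Pred Carrier 0ℓ
    First x = R x × index x ℕ.< index (g x)

    first? : Decidable First
    first? x = R? x ×-dec (index x ℕ.<? index (g x))

    partner-first : ∀ x → R x → ¬ index x ℕ.< index (g x) → First (g x)
    partner-first x r x≮gx = g-preserves x r , subst (λ y → index (g x) ℕ.< index y) (sym (g-involutive x)) gx<x
      where
      gx<x : index (g x) ℕ.< index x
      gx<x = ℕₚ.≤∧≢⇒< (ℕₚ.≮⇒≥ x≮gx) (λ eq → g-no-fixed-point x r (index-injective eq))

    count-pairs : count R? ≡ count first? ℕ.+ count first?
    count-pairs = begin
      count R?
        ≡⟨ count-split R? (λ x → index x ℕ.<? index (g x)) ⟩
      count first? ℕ.+ count (λ x → R? x ×-dec ¬? (index x ℕ.<? index (g x)))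
        ≡⟨ cong (count first? ℕ.+_) (count-cong _ (first? ∘ g) (second⇒partner , partner⇒second)) ⟩
      count first? ℕ.+ count (first? ∘ g)
        ≡⟨ cong (count first? ℕ.+_) (count-involution first? g g-involutive) ⟩
      count first? ℕ.+ count first?
        ∎
      where
      second⇒partner : ∀ {x} → R x × ¬ index x ℕ.< index (g x) → First (g x)
      second⇒partner {x} (r , x≮gx) = partner-first x r x≮gx
      partner⇒second : ∀ {x} → First (g x) → R x × ¬ index x ℕ.< index (g x)
      partner⇒second {x} (rgx , gx<ggx) =
        subst R (g-involutive x) (g-preserves (g x) rgx) ,
        λ x<gx → ℕₚ.<-asym x<gx (subst (λ y → index (g x) ℕ.< index y) (g-involutive x) gx<ggx)

  -- A finite field of even order has characteristic two: otherwise x ↦ - x would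
  -- pair off the non-zero elements, making the order odd.
  characteristic-two : ∀ n → size ≡ 2 ℕ.* n → 1# + 1# ≡ 0#
  characteristic-two n size≡2n with (1# + 1#) ≟ 0#
  ... | yes 2≡0 = 2≡0
  ... | no  2≢0 = ⊥-elim (ℕₚ.even≢odd n (count first?) (trans (sym size≡2n) size-odd))
    where
    -x≢0 : ∀ x → ¬ x ≡ 0# → ¬ - x ≡ 0#
    -x≢0 x x≢0 -x≡0 = x≢0 (trans (sym (-‿involutive x)) (trans (cong -_ -x≡0) -0#≈0#))
    -x≢x : ∀ x → ¬ x ≡ 0# → ¬ - x ≡ x
    -x≢x x x≢0 -x≡x with no-zero-divisors (1# + 1#) x (begin
      (1# + 1#) * x     ≡⟨ distribʳ x 1# 1# ⟩
      1# * x + 1# * x   ≡⟨ cong₂ _+_ (*-identityˡ x) (*-identityˡ x) ⟩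
      x + x             ≡⟨ cong (x +_) (sym -x≡x) ⟩
      x + - x           ≡⟨ -‿inverseʳ x ⟩
      0#                ∎)
    ... | inj₁ 2≡0 = 2≢0 2≡0
    ... | inj₂ x≡0 = x≢0 x≡0
    open Pairing (¬? ∘ (_≟ 0#)) -_ -‿involutive -x≢0 -x≢x
    size-odd : size ≡ ℕ.suc (2 ℕ.* count first?)
    size-odd = begin
      size                                          ≡⟨ sym (count-complement (_≟ 0#)) ⟩
      count (_≟ 0#) ℕ.+ count (¬? ∘ (_≟ 0#))        ≡⟨ cong₂ ℕ._+_ (count-single 0#) count-pairs ⟩
      ℕ.suc (count first? ℕ.+ count first?)
        ≡⟨ cong (λ c → ℕ.suc (count first? ℕ.+ c)) (sym (ℕₚ.+-identityʳ _)) ⟩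
      ℕ.suc (2 ℕ.* count first?)                    ∎

  -- Fermat's little theorem: x ^ size ≡ x.  For a ≢ 0, multiplication by a permutes
  -- the non-zero elements, so a ^ (size - 1) times their product is their product.
  module Fermat where
    product : List Carrier → Carrier
    product = foldr _*_ 1#

    product-↭ : ∀ {xs ys} → xs ↭ ys → product xs ≡ product ys
    product-↭ σ = PermutationProperties.foldr-commMonoid (setoid Carrier) *-isCommutativeMonoid (↭⇒↭ₛ σ)

    product-scale : ∀ a xs → product (map (a *_) xs) ≡ pow a (length xs) * product xs
    product-scale a [] = sym (*-identityˡ 1#)
    product-scale a (x ∷ xs) = begin
      (a * x) * product (map (a *_) xs)          ≡⟨ cong ((a * x) *_) (product-scale a xs) ⟩
      (a * x) * (pow a (length xs) * product xs) ≡⟨ *-interchange a x (pow a (length xs)) (product xs) ⟩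
      (a * pow a (length xs)) * (x * product xs) ∎

    product-nonzero : ∀ xs → All (λ x → ¬ x ≡ 0#) xs → ¬ product xs ≡ 0#
    product-nonzero []       []           1≡0 = 0≢1 (sym 1≡0)
    product-nonzero (x ∷ xs) (x≢0 ∷ xs≢0) p≡0 with no-zero-divisors x (product xs) p≡0
    ... | inj₁ x≡0 = x≢0 x≡0
    ... | inj₂ q≡0 = product-nonzero xs xs≢0 q≡0

    nonzero? : Decidable (λ x → ¬ x ≡ 0#)
    nonzero? = ¬? ∘ (_≟ 0#)

    nonzeros : List Carrier
    nonzeros = filter nonzero? elements

    nonzeros-unique : Unique nonzeros
    nonzeros-unique = Unique.filter⁺ nonzero? elements-unique

    ∈-nonzeros⁻ : ∀ {x} → x ∈ nonzeros → ¬ x ≡ 0#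
    ∈-nonzeros⁻ x∈ = proj₂ (∈-filter⁻ nonzero? {xs = elements} x∈)

    ∈-nonzeros⁺ : ∀ {x} → ¬ x ≡ 0# → x ∈ nonzeros
    ∈-nonzeros⁺ {x} = ∈-filter⁺ nonzero? (∈-elements x)

    size≡1+#nonzeros : size ≡ ℕ.suc (length nonzeros)
    size≡1+#nonzeros = trans (sym (count-complement (_≟ 0#))) (cong (ℕ._+ length nonzeros) (count-single 0#))

    scaling-permutes : ∀ a → ¬ a ≡ 0# → map (a *_) nonzeros ↭ nonzeros
    scaling-permutes a a≢0 with inverse a a≢0
    ... | a⁻¹ , aa⁻¹≡1 = unique-same-members⇒↭
        (Unique.map⁺ (*-cancelˡ a a≢0) nonzeros-unique) nonzeros-unique image⊆ ⊆image
      where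
      image⊆ : ∀ {y} → y ∈ map (a *_) nonzeros → y ∈ nonzeros
      image⊆ y∈ with ∈-map⁻ (a *_) y∈
      ... | x , x∈ , refl = ∈-nonzeros⁺ λ ax≡0 → [ a≢0 , ∈-nonzeros⁻ x∈ ]′ (no-zero-divisors a x ax≡0)
      a[a⁻¹y]≡y : ∀ y → a * (a⁻¹ * y) ≡ y
      a[a⁻¹y]≡y y = trans (sym (*-assoc a a⁻¹ y)) (trans (cong (_* y) aa⁻¹≡1) (*-identityˡ y))
      ⊆image : ∀ {y} → y ∈ nonzeros → y ∈ map (a *_) nonzeros
      ⊆image {y} y∈ = subst (_∈ map (a *_) nonzeros) (a[a⁻¹y]≡y y) (∈-map⁺ (a *_) (∈-nonzeros⁺ a⁻¹y≢0))
        where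
        a⁻¹y≢0 : ¬ a⁻¹ * y ≡ 0#
        a⁻¹y≢0 z = ∈-nonzeros⁻ y∈ (trans (sym (a[a⁻¹y]≡y y)) (trans (cong (a *_) z) (zeroʳ a)))

    fermat-nonzero : ∀ a → ¬ a ≡ 0# → pow a (length nonzeros) ≡ 1#
    fermat-nonzero a a≢0 =
      *-cancelˡ (product nonzeros) (product-nonzero nonzeros (All.tabulate ∈-nonzeros⁻)) (begin
        product nonzeros * pow a (length nonzeros)   ≡⟨ *-comm _ _ ⟩
        pow a (length nonzeros) * product nonzeros   ≡⟨ sym (product-scale a nonzeros) ⟩
        product (map (a *_) nonzeros)                ≡⟨ product-↭ (scaling-permutes a a≢0) ⟩
        product nonzeros                             ≡⟨ sym (*-identityʳ _) ⟩
        product nonzeros * 1#                        ∎)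

  fermat : ∀ x → pow x size ≡ x
  fermat x rewrite Fermat.size≡1+#nonzeros with x ≟ 0#
  ... | yes refl = zeroˡ _
  ... | no  x≢0  = trans (cong (x *_) (Fermat.fermat-nonzero x x≢0)) (*-identityʳ x)

  module CharacteristicTwo (1+1≡0 : 1# + 1# ≡ 0#) where

    x+x≡0 : ∀ x → x + x ≡ 0#
    x+x≡0 x = begin
      x + x               ≡⟨ cong₂ _+_ (sym (*-identityˡ x)) (sym (*-identityˡ x)) ⟩
      1# * x + 1# * x     ≡⟨ sym (distribʳ x 1# 1#) ⟩
      (1# + 1#) * x       ≡⟨ cong (_* x) 1+1≡0 ⟩
      0# * x              ≡⟨ zeroˡ x ⟩
      0#                  ∎

    translate-involutive : ∀ u x → (x + u) + u ≡ x
    translate-involutive u x = begin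
      (x + u) + u   ≡⟨ +-assoc x u u ⟩
      x + (u + u)   ≡⟨ cong (x +_) (x+x≡0 u) ⟩
      x + 0#        ≡⟨ +-identityʳ x ⟩
      x             ∎

    x+[x+u]≡u : ∀ x u → x + (x + u) ≡ u
    x+[x+u]≡u x u = trans (sym (+-assoc x x u)) (trans (cong (_+ u) (x+x≡0 x)) (+-identityˡ u))

    sum≡0⇒≡ : ∀ x y → x + y ≡ 0# → x ≡ y
    sum≡0⇒≡ x y x+y≡0 = begin
      x             ≡⟨ sym (translate-involutive y x) ⟩
      (x + y) + y   ≡⟨ cong (_+ y) x+y≡0 ⟩
      0# + y        ≡⟨ +-identityˡ y ⟩
      y             ∎

    translates-difference : ∀ c x y → (x + c) + (y + c) ≡ x + y
    translates-difference c x y = begin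
      (x + c) + (y + c)   ≡⟨ interchange x c y c ⟩
      (x + y) + (c + c)   ≡⟨ cong ((x + y) +_) (x+x≡0 c) ⟩
      (x + y) + 0#        ≡⟨ +-identityʳ (x + y) ⟩
      x + y               ∎

    translate-through : ∀ w x c → (x + w) + (w + c) ≡ x + c
    translate-through w x c = trans (cong ((x + w) +_) (+-comm w c)) (translates-difference w x c)

    square-+ : ∀ x y → (x + y) * (x + y) ≡ x * x + y * y
    square-+ x y = begin
      (x + y) * (x + y)                   ≡⟨ distribʳ (x + y) x y ⟩
      x * (x + y) + y * (x + y)           ≡⟨ cong₂ _+_ (distribˡ x x y) (distribˡ y x y) ⟩
      (x * x + x * y) + (y * x + y * y)   ≡⟨ cong ((x * x + x * y) +_) (+-comm (y * x) (y * y)) ⟩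
      (x * x + x * y) + (y * y + y * x)   ≡⟨ interchange (x * x) (x * y) (y * y) (y * x) ⟩
      (x * x + y * y) + (x * y + y * x)   ≡⟨ cong (λ z → (x * x + y * y) + (x * y + z)) (*-comm y x) ⟩
      (x * x + y * y) + (x * y + x * y)   ≡⟨ cong ((x * x + y * y) +_) (x+x≡0 (x * y)) ⟩
      (x * x + y * y) + 0#                ≡⟨ +-identityʳ _ ⟩
      x * x + y * y                       ∎

    frob : ℕ → Carrier → Carrier
    frob ℕ.zero    x = x
    frob (ℕ.suc n) x = frob n (x * x)

    pow-2^≡frob : ∀ n x → pow x (2 ^ n) ≡ frob n x
    pow-2^≡frob ℕ.zero    x = *-identityʳ x
    pow-2^≡frob (ℕ.suc n) x = begin
      pow x (2 ℕ.* 2 ^ n)     ≡⟨ pow-* x 2 (2 ^ n) ⟩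
      pow (pow x 2) (2 ^ n)   ≡⟨ cong (λ y → pow (x * y) (2 ^ n)) (*-identityʳ x) ⟩
      pow (x * x) (2 ^ n)     ≡⟨ pow-2^≡frob n (x * x) ⟩
      frob n (x * x)          ∎

    frob-+ : ∀ n x y → frob n (x + y) ≡ frob n x + frob n y
    frob-+ ℕ.zero    x y = refl
    frob-+ (ℕ.suc n) x y = trans (cong (frob n) (square-+ x y)) (frob-+ n (x * x) (y * y))

    frob-∘ : ∀ a b x → frob (a ℕ.+ b) x ≡ frob b (frob a x)
    frob-∘ ℕ.zero    b x = refl
    frob-∘ (ℕ.suc a) b x = frob-∘ a b (x * x)

    -- The exponents n for which z is fixed by frob n are closed under the
    -- operations of Euclid's algorithm, hence contain every gcd.
    Fixed : ℕ → Carrier → Set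
    Fixed n z = frob n z ≡ z

    fixed-+ : ∀ a b {z} → Fixed a z → Fixed b z → Fixed (a ℕ.+ b) z
    fixed-+ a b {z} fa fb = trans (frob-∘ a b z) (trans (cong (frob b) fa) fb)

    fixed-* : ∀ k a {z} → Fixed a z → Fixed (k ℕ.* a) z
    fixed-* ℕ.zero    a fa = refl
    fixed-* (ℕ.suc k) a fa = fixed-+ a (k ℕ.* a) fa (fixed-* k a fa)

    fixed-∸ : ∀ a b {z} → Fixed (a ℕ.+ b) z → Fixed b z → Fixed a z
    fixed-∸ a b {z} fab fb = begin
      frob a z             ≡⟨ cong (frob a) (sym fb) ⟩
      frob a (frob b z)    ≡⟨ sym (frob-∘ b a z) ⟩
      frob (b ℕ.+ a) z     ≡⟨ cong (λ n → frob n z) (ℕₚ.+-comm b a) ⟩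
      frob (a ℕ.+ b) z     ≡⟨ fab ⟩
      z                    ∎

    fixed-gcd : ∀ h m {z} → gcd h m ≡ 1 → Fixed h z → Fixed m z → Fixed 1 z
    fixed-gcd h m {z} gcd≡1 fh fm with Bézout.identity (subst (GCD h m) gcd≡1 (gcd-GCD h m))
    ... | Bézout.+- x y 1+ym≡xh = fixed-∸ 1 (y ℕ.* m) (subst (λ n → Fixed n z) (sym 1+ym≡xh) (fixed-* x h fh))
                                          (fixed-* y m fm)
    ... | Bézout.-+ x y 1+xh≡ym = fixed-∸ 1 (x ℕ.* h) (subst (λ n → Fixed n z) (sym 1+xh≡ym) (fixed-* y m fm))
                                          (fixed-* x h fh)

    idempotent : ∀ z → z * z ≡ z → z ≡ 0# ⊎ z ≡ 1#
    idempotent z zz≡z with z ≟ 0#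
    ... | yes z≡0 = inj₁ z≡0
    ... | no  z≢0 = inj₂ (*-cancelˡ z z≢0 (trans zz≡z (sym (*-identityʳ z))))

    -- An additive map whose kernel is {0, t} with t ≢ 0 is two-to-one, so its image
    -- is half of the field: choosing one representative of each pair {x, x + t}, the
    -- map is a bijection from the representatives onto its image.
    module TwoToOne (g : Carrier → Carrier) (g-+ : ∀ x y → g (x + y) ≡ g x + g y)
                    (t : Carrier) (t≢0 : ¬ t ≡ 0#) (gt≡0 : g t ≡ 0#)
                    (kernel : ∀ z → g z ≡ 0# → z ≡ 0# ⊎ z ≡ t) where

      image : List Carrier
      image = map g elements

      image? : Decidable (_∈ image)
      image? y = y ∈? image

      private
        ⊤? : Decidable {A = Carrier} (λ _ → ⊤)
        ⊤? _ = yes tt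

        x+t≢x : ∀ x → ⊤ → ¬ x + t ≡ x
        x+t≢x x _ x+t≡x = t≢0 (begin
          t               ≡⟨ sym (translate-involutive x t) ⟩
          (t + x) + x     ≡⟨ cong (_+ x) (trans (+-comm t x) x+t≡x) ⟩
          x + x           ≡⟨ x+x≡0 x ⟩
          0#              ∎)

      open Pairing ⊤? (_+ t) (translate-involutive t) (λ _ _ → tt) x+t≢x

      representatives : List Carrier
      representatives = filter first? elements

      private
        rep-first : ∀ {x} → x ∈ representatives → index x ℕ.< index (x + t)
        rep-first x∈ = proj₂ (proj₂ (∈-filter⁻ first? {xs = elements} x∈))

        g-injective-on-reps : ∀ {a c} → a ∈ representatives → c ∈ representatives → g a ≡ g c → a ≡ c
        g-injective-on-reps {a} {c} a∈ c∈ ga≡gc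
          with kernel (a + c) (trans (g-+ a c) (trans (cong (_+ g c) ga≡gc) (x+x≡0 (g c))))
        ... | inj₁ a+c≡0 = sum≡0⇒≡ a c a+c≡0
        ... | inj₂ a+c≡t = ⊥-elim (ℕₚ.<-asym (subst (λ y → index a ℕ.< index y) a+t≡c (rep-first a∈))
                                             (subst (λ y → index c ℕ.< index y) c+t≡a (rep-first c∈)))
          where
          a+t≡c : a + t ≡ c
          a+t≡c = trans (cong (a +_) (sym a+c≡t)) (x+[x+u]≡u a c)
          c+t≡a : c + t ≡ a
          c+t≡a = trans (cong (_+ t) (sym a+t≡c)) (translate-involutive t a)

        image-via-reps : ∀ {y} → y ∈ image → y ∈ map g representatives
        image-via-reps y∈ with ∈-map⁻ g y∈
        ... | x , _ , refl with first? x
        ... | yes first = ∈-map⁺ g (∈-filter⁺ first? (∈-elements x) first)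
        ... | no ¬first = subst (_∈ map g representatives) g[x+t]≡gx
                            (∈-map⁺ g (∈-filter⁺ first? (∈-elements (x + t)) (partner-first x tt (¬first ∘ (tt ,_)))))
          where
          g[x+t]≡gx : g (x + t) ≡ g x
          g[x+t]≡gx = trans (g-+ x t) (trans (cong (g x +_) gt≡0) (+-identityʳ (g x)))

        reps↭image : map g representatives ↭ filter image? elements
        reps↭image = unique-same-members⇒↭
          (unique-map-injectiveOn g (Unique.filter⁺ first? elements-unique) g-injective-on-reps)
          (Unique.filter⁺ image? elements-unique)
          (λ {y} y∈ → ∈-filter⁺ image? (∈-elements y) (image-of-rep y∈))
          (λ y∈ → image-via-reps (proj₂ (∈-filter⁻ image? {xs = elements} y∈)))
          where
          image-of-rep : ∀ {y} → y ∈ map g representatives → y ∈ image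
          image-of-rep y∈ with ∈-map⁻ g y∈
          ... | x , _ , refl = ∈-map⁺ g (∈-elements x)

      image-size : count image? ℕ.+ count image? ≡ size
      image-size = begin
        count image? ℕ.+ count image?   ≡⟨ cong₂ ℕ._+_ #image≡#reps #image≡#reps ⟩
        count first? ℕ.+ count first?   ≡⟨ sym count-pairs ⟩
        count ⊤?                        ≡⟨ count-all ⊤? (λ _ → tt) ⟩
        size                            ∎
        where
        #image≡#reps : count image? ≡ count first?
        #image≡#reps = trans (sym (↭-length reps↭image)) (length-map g representatives)

    module HalfSubgroups (k : ℕ) (size≡k+k : size ≡ k ℕ.+ k) where

      record HalfSubgroup : Set₁ where
        field
          Member   : Pred Carrier 0ℓ
          member?  : Decidable Member
          +-closed : ∀ {x y} → Member x → Member y → Member (x + y)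
          0-member : Member 0#
          count≡k  : count member? ≡ k

      open HalfSubgroup

      -- the coset H + c as a predicate (in characteristic two, x ∈ H + c ⟺ x + c ∈ H)
      Coset : HalfSubgroup → Carrier → Pred Carrier 0ℓ
      Coset H c x = Member H (x + c)

      module _ (H : HalfSubgroup) where

        complement-count : count (¬? ∘ member? H) ≡ k
        complement-count = ℕₚ.+-cancelˡ-≡ k _ _ (trans (cong (ℕ._+ count (¬? ∘ member? H)) (sym (count≡k H)))
                             (trans (count-complement (member? H)) size≡k+k))

        member-cancel : ∀ {x u} → Member H x → Member H (x + u) → Member H u
        member-cancel {x} {u} x∈H x+u∈H = subst (Member H) (x+[x+u]≡u x u) (+-closed H x∈H x+u∈H)

        coset⇒shifted : ∀ {c w x} → Coset H c w → Coset H c x → Member H (x + w)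
        coset⇒shifted {c} {w} {x} w∈ x∈ = subst (Member H) (translates-difference c x w) (+-closed H x∈ w∈)

        shifted⇒coset : ∀ {c w x} → Coset H c w → Member H (x + w) → Coset H c x
        shifted⇒coset {c} {w} {x} w∈ x+w∈ = subst (Member H) (translate-through w x c) (+-closed H x+w∈ w∈)

        -- H has index two: the complement of H is a single coset, so two
        -- non-members differ by a member.
        outside+outside : ∀ {u v} → ¬ Member H u → ¬ Member H v → Member H (v + u)
        outside+outside {u} {v} u∉H v∉H =
          decidable-stable (member? H (v + u)) λ v+u∉H → count-zero both-outside? none-both-outside v (v∉H , v+u∉H)
          where
          outside? : Decidable (λ x → ¬ Member H x)
          outside? = ¬? ∘ member? H
          both-outside? : Decidable (λ x → ¬ Member H x × ¬ Member H (x + u))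
          both-outside? x = outside? x ×-dec ¬? (member? H (x + u))
          translate-outside : ∀ {x} → Member H (x + u) → ¬ Member H x
          translate-outside x+u∈H x∈H = u∉H (member-cancel x∈H x+u∈H)
          #translate-outside : count (λ x → outside? x ×-dec member? H (x + u)) ≡ k
          #translate-outside = begin
            count (λ x → outside? x ×-dec member? H (x + u))
              ≡⟨ count-cong _ (member? H ∘ (_+ u)) (proj₂ , λ x+u∈H → translate-outside x+u∈H , x+u∈H) ⟩
            count (member? H ∘ (_+ u))   ≡⟨ count-involution (member? H) (_+ u) (translate-involutive u) ⟩
            count (member? H)            ≡⟨ count≡k H ⟩
            k                            ∎
          none-both-outside : count both-outside? ≡ 0
          none-both-outside = ℕₚ.+-cancelˡ-≡ k _ _ (begin
            k ℕ.+ count both-outside?    ≡⟨ cong (ℕ._+ count both-outside?) (sym #translate-outside) ⟩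
            count (λ x → outside? x ×-dec member? H (x + u)) ℕ.+ count both-outside?
                                         ≡⟨ sym (count-split outside? (member? H ∘ (_+ u))) ⟩
            count outside?               ≡⟨ complement-count ⟩
            k                            ≡⟨ sym (ℕₚ.+-identityʳ k) ⟩
            k ℕ.+ 0                      ∎)

      module Pair (H₁ H₂ : HalfSubgroup) where

        both? : Decidable (λ x → Member H₁ x × Member H₂ x)
        both? x = member? H₁ x ×-dec member? H₂ x

        meet? : ∀ c₁ c₂ → Decidable (λ x → Coset H₁ c₁ x × Coset H₂ c₂ x)
        meet? c₁ c₂ x = member? H₁ (x + c₁) ×-dec member? H₂ (x + c₂)

        -- If u ∈ H₁ ∖ H₂, translation by u exchanges H₁ ∩ H₂ and H₁ ∖ H₂.
        half-intersection : ∀ {u} → Member H₁ u → ¬ Member H₂ u → count both? ℕ.+ count both? ≡ k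
        half-intersection {u} u∈H₁ u∉H₂ = begin
          count both? ℕ.+ count both?
            ≡⟨ cong (count both? ℕ.+_) (sym (count-involution both? (_+ u) (translate-involutive u))) ⟩
          count both? ℕ.+ count (both? ∘ (_+ u))
            ≡⟨ cong (count both? ℕ.+_) (count-cong (both? ∘ (_+ u)) _ (back , forth)) ⟩
          count both? ℕ.+ count (λ x → member? H₁ x ×-dec ¬? (member? H₂ x))
            ≡⟨ sym (count-split (member? H₁) (member? H₂)) ⟩
          count (member? H₁)   ≡⟨ count≡k H₁ ⟩
          k                    ∎
          where
          forth : ∀ {x} → Member H₁ x × ¬ Member H₂ x → Member H₁ (x + u) × Member H₂ (x + u)
          forth (x∈H₁ , x∉H₂) = +-closed H₁ x∈H₁ u∈H₁ , outside+outside H₂ u∉H₂ x∉H₂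
          back : ∀ {x} → Member H₁ (x + u) × Member H₂ (x + u) → Member H₁ x × ¬ Member H₂ x
          back {x} (x+u∈H₁ , x+u∈H₂) =
            subst (Member H₁) (translate-involutive u x) (+-closed H₁ x+u∈H₁ u∈H₁) ,
            λ x∈H₂ → u∉H₂ (member-cancel H₂ x∈H₂ x+u∈H₂)

        -- A non-empty intersection of cosets is a translate of H₁ ∩ H₂.
        meet-count : ∀ {c₁ c₂ w} → Coset H₁ c₁ w → Coset H₂ c₂ w → count (meet? c₁ c₂) ≡ count both?
        meet-count {c₁} {c₂} {w} w∈₁ w∈₂ =
          trans (count-cong (meet? c₁ c₂) (both? ∘ (_+ w)) (forth , back))
                (count-involution both? (_+ w) (translate-involutive w))
          where
          forth : ∀ {x} → Coset H₁ c₁ x × Coset H₂ c₂ x → Member H₁ (x + w) × Member H₂ (x + w)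
          forth (x∈₁ , x∈₂) = coset⇒shifted H₁ w∈₁ x∈₁ , coset⇒shifted H₂ w∈₂ x∈₂
          back : ∀ {x} → Member H₁ (x + w) × Member H₂ (x + w) → Coset H₁ c₁ x × Coset H₂ c₂ x
          back (x+w∈H₁ , x+w∈H₂) = shifted⇒coset H₁ w∈₁ x+w∈H₁ , shifted⇒coset H₂ w∈₂ x+w∈H₂

        cosets-meet : ∀ {u} c₁ c₂ → Member H₁ u → ¬ Member H₂ u → ∃ λ w → Coset H₁ c₁ w × Coset H₂ c₂ w
        cosets-meet {u} c₁ c₂ u∈H₁ u∉H₂ with member? H₂ (c₁ + c₂)
        ... | yes c₁+c₂∈H₂ = c₁ , subst (Member H₁) (sym (x+x≡0 c₁)) (0-member H₁) , c₁+c₂∈H₂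
        ... | no  c₁+c₂∉H₂ = u + c₁ , subst (Member H₁) (sym (translate-involutive c₁ u)) u∈H₁ ,
                             subst (Member H₂) eq (outside+outside H₂ u∉H₂ c₁+c₂∉H₂)
          where
          eq : (c₁ + c₂) + u ≡ (u + c₁) + c₂
          eq = trans (+-comm (c₁ + c₂) u) (sym (+-assoc u c₁ c₂))

        disjoint-cosets : ∀ c₁ c₂ → Member H₁ ≐ Member H₂ → ¬ (Coset H₁ c₁ ≐ Coset H₂ c₂) →
                          count (meet? c₁ c₂) ≡ 0
        disjoint-cosets c₁ c₂ (H₁⊆H₂ , H₂⊆H₁) cosets≢ = count-none (meet? c₁ c₂) λ w (w∈₁ , w∈₂) →
          cosets≢ ( (λ x∈₁ → shifted⇒coset H₂ w∈₂ (H₁⊆H₂ (coset⇒shifted H₁ w∈₁ x∈₁)))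
                  , (λ x∈₂ → shifted⇒coset H₁ w∈₁ (H₂⊆H₁ (coset⇒shifted H₂ w∈₂ x∈₂))) )

        meet-half : ∀ {u} c₁ c₂ → Member H₁ u → ¬ Member H₂ u →
                    count (meet? c₁ c₂) ℕ.+ count (meet? c₁ c₂) ≡ k
        meet-half c₁ c₂ u∈H₁ u∉H₂ with cosets-meet c₁ c₂ u∈H₁ u∉H₂
        ... | w , w∈₁ , w∈₂ = trans (cong₂ ℕ._+_ (meet-count w∈₁ w∈₂) (meet-count w∈₁ w∈₂))
                                    (half-intersection u∈H₁ u∉H₂)

        differ? : Decidable (λ x → (Member H₁ x × ¬ Member H₂ x) ⊎ (Member H₂ x × ¬ Member H₁ x))
        differ? x = (member? H₁ x ×-dec ¬? (member? H₂ x)) ⊎-dec (member? H₂ x ×-dec ¬? (member? H₁ x))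

        same-members : count differ? ≡ 0 → Member H₁ ≐ Member H₂
        same-members none =
          (λ {x} x∈H₁ → decidable-stable (member? H₂ x) λ x∉H₂ →
             count-zero differ? none x (inj₁ (x∈H₁ , x∉H₂))) ,
          (λ {x} x∈H₂ → decidable-stable (member? H₁ x) λ x∉H₁ →
             count-zero differ? none x (inj₂ (x∈H₂ , x∉H₁)))

      coset-intersection : ∀ H₁ H₂ c₁ c₂ → ¬ (Coset H₁ c₁ ≐ Coset H₂ c₂) →
        let open Pair H₁ H₂ in
        count (meet? c₁ c₂) ≡ 0 ⊎ count (meet? c₁ c₂) ℕ.+ count (meet? c₁ c₂) ≡ k
      coset-intersection H₁ H₂ c₁ c₂ cosets≢ with count (Pair.differ? H₁ H₂) ℕ.≟ 0
      ... | yes none = inj₁ (Pair.disjoint-cosets H₁ H₂ c₁ c₂ (Pair.same-members H₁ H₂ none) cosets≢)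
      ... | no  some with count-witness (Pair.differ? H₁ H₂) some
      ... | u , inj₁ (u∈H₁ , u∉H₂) = inj₂ (Pair.meet-half H₁ H₂ c₁ c₂ u∈H₁ u∉H₂)
      ... | u , inj₂ (u∈H₂ , u∉H₁) = inj₂ (begin
        count meet₁₂ ℕ.+ count meet₁₂   ≡⟨ cong₂ ℕ._+_ swap swap ⟩
        count meet₂₁ ℕ.+ count meet₂₁   ≡⟨ Pair.meet-half H₂ H₁ c₂ c₁ u∈H₂ u∉H₁ ⟩
        k                               ∎)
        where
        meet₁₂ : Decidable (λ x → Coset H₁ c₁ x × Coset H₂ c₂ x)
        meet₁₂ = Pair.meet? H₁ H₂ c₁ c₂
        meet₂₁ : Decidable (λ x → Coset H₂ c₂ x × Coset H₁ c₁ x)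
        meet₂₁ = Pair.meet? H₂ H₁ c₂ c₁
        swap : count meet₁₂ ≡ count meet₂₁
        swap = count-cong meet₁₂ meet₂₁ ((λ (a , b) → b , a) , (λ (a , b) → b , a))

    -- The blocks B(b, c) = {f x + b x + c} for f x = x ^ (2 ^ h).  Since f is additive,
    -- x ↦ f x + b x is additive and B(b, c) is the coset of its image by c.
    module Blocks (h : ℕ) where

      f : Carrier → Carrier
      f x = pow x (2 ^ h)

      f-+ : ∀ x y → f (x + y) ≡ f x + f y
      f-+ x y = begin
        f (x + y)                 ≡⟨ pow-2^≡frob h (x + y) ⟩
        frob h (x + y)            ≡⟨ frob-+ h x y ⟩
        frob h x + frob h y       ≡⟨ sym (cong₂ _+_ (pow-2^≡frob h x) (pow-2^≡frob h y)) ⟩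
        f x + f y                 ∎

      L : Carrier → Carrier → Carrier
      L b x = f x + b * x

      L-+ : ∀ b x y → L b (x + y) ≡ L b x + L b y
      L-+ b x y = begin
        f (x + y) + b * (x + y)          ≡⟨ cong₂ _+_ (f-+ x y) (distribˡ b x y) ⟩
        (f x + f y) + (b * x + b * y)    ≡⟨ interchange (f x) (f y) (b * x) (b * y) ⟩
        (f x + b * x) + (f y + b * y)    ∎

      image : Carrier → List Carrier
      image b = map (L b) elements

      image? : ∀ b → Decidable (_∈ image b)
      image? b y = y ∈? image b

      ∈-image : ∀ b x → L b x ∈ image b
      ∈-image b x = ∈-map⁺ (L b) (∈-elements x)

      image-+ : ∀ b {y z} → y ∈ image b → z ∈ image b → y + z ∈ image b
      image-+ b y∈ z∈ with ∈-map⁻ (L b) y∈ | ∈-map⁻ (L b) z∈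
      ... | x , _ , refl | x′ , _ , refl = subst (_∈ image b) (L-+ b x x′) (∈-image b (x + x′))

      0∈image : ∀ b → 0# ∈ image b
      0∈image b = subst (_∈ image b) (x+x≡0 (L b 0#)) (image-+ b (∈-image b 0#) (∈-image b 0#))

      B : Carrier → Carrier → List Carrier
      B = block f

      B⇒image : ∀ b c {y} → y ∈ B b c → y + c ∈ image b
      B⇒image b c y∈ with ∈-map⁻ (λ x → L b x + c) y∈
      ... | x , _ , refl = subst (_∈ image b) (sym (translate-involutive c (L b x))) (∈-image b x)

      image⇒B : ∀ b c {y} → y + c ∈ image b → y ∈ B b c
      image⇒B b c {y} y+c∈ with ∈-map⁻ (L b) y+c∈
      ... | x , _ , y+c≡Lx = subst (_∈ B b c) (trans (cong (_+ c) (sym y+c≡Lx)) (translate-involutive c y))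
                                (∈-map⁺ (λ x → L b x + c) (∈-elements x))

      card-B : ∀ b c → card (B b c) ≡ count (image? b)
      card-B b c = begin
        card (B b c)                  ≡⟨ count-cong _ (image? b ∘ (_+ c)) (B⇒image b c , image⇒B b c) ⟩
        count (image? b ∘ (_+ c))     ≡⟨ count-involution (image? b) (_+ c) (translate-involutive c) ⟩
        count (image? b)              ∎

      -- When size ≡ k + k, blocks with k points are cosets of half-subgroups, so two
      -- distinct ones meet in no point or in k/2 points.
      module HalfBlocks (k : ℕ) (size≡k+k : size ≡ k ℕ.+ k) where
        open HalfSubgroups k size≡k+k public

        image-subgroup : ∀ b → count (image? b) ≡ k → HalfSubgroup
        image-subgroup b #image≡k = record
          { Member = _∈ image b ; member? = image? b ; +-closed = image-+ b
          ; 0-member = 0∈image b ; count≡k = #image≡k }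

        block-intersection : ∀ b c b′ c′ → card (B b c) ≡ k → card (B b′ c′) ≡ k →
          ¬ SameSet (B b c) (B b′ c′) →
          interSize (B b c) (B b′ c′) ≡ 0 ⊎ interSize (B b c) (B b′ c′) ℕ.+ interSize (B b c) (B b′ c′) ≡ k
        block-intersection b c b′ c′ #B≡k #B′≡k B≢B′ =
          Sum.map (trans interSize≡) (trans (cong₂ ℕ._+_ interSize≡ interSize≡)) (coset-intersection H H′ c c′ cosets≢)
          where
          H H′ : HalfSubgroup
          H  = image-subgroup b  (trans (sym (card-B b c)) #B≡k)
          H′ = image-subgroup b′ (trans (sym (card-B b′ c′)) #B′≡k)
          interSize≡ : interSize (B b c) (B b′ c′) ≡ count (Pair.meet? H H′ c c′)
          interSize≡ = count-cong _ (Pair.meet? H H′ c c′)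
            ( (λ (y∈ , y∈′) → B⇒image b c y∈ , B⇒image b′ c′ y∈′)
            , (λ (y∈ , y∈′) → image⇒B b c y∈ , image⇒B b′ c′ y∈′) )
          cosets≢ : ¬ (Coset H c ≐ Coset H′ c′)
          cosets≢ (H+c⊆H′+c′ , H′+c′⊆H+c) = B≢B′ λ y →
            (λ y∈ → image⇒B b′ c′ (H+c⊆H′+c′ (B⇒image b c y∈))) ,
            (λ y∈ → image⇒B b c (H′+c′⊆H+c (B⇒image b′ c′ y∈)))

      -- When every element is fixed by frob m and gcd h m ≡ 1, the slopes
      -- b = t ^ (2 ^ h - 1) with t ≢ 0 give maps L b with kernel exactly {0, t}.
      module Slopes (m : ℕ) (frob-m : ∀ z → Fixed m z) (coprime : gcd h m ≡ 1) where

        e : ℕ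
        e = 2 ^ h ℕ.∸ 1

        slope : Carrier → Carrier
        slope t = pow t e

        slope-one : slope 1# ≡ 1#
        slope-one = pow-one e

        slope-t*t : ∀ t → slope t * t ≡ f t
        slope-t*t t = trans (*-comm (pow t e) t) (cong (pow t) 1+e≡2^h)
          where
          1+e≡2^h : ℕ.suc e ≡ 2 ^ h
          1+e≡2^h = trans (ℕₚ.+-comm 1 e) (ℕₚ.m∸n+n≡m (ℕₚ.m^n>0 2 h))

        L-scaling : ∀ t w → L (slope t) (t * w) ≡ f t * (f w + w)
        L-scaling t w = begin
          f (t * w) + slope t * (t * w)    ≡⟨ cong₂ _+_ (pow-distrib t w (2 ^ h)) (sym (*-assoc (slope t) t w)) ⟩
          f t * f w + (slope t * t) * w    ≡⟨ cong (λ y → f t * f w + y * w) (slope-t*t t) ⟩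
          f t * f w + f t * w              ≡⟨ sym (distribˡ (f t) (f w) w) ⟩
          f t * (f w + w)                  ∎

        L-root : ∀ t → L (slope t) t ≡ 0#
        L-root t = trans (cong (f t +_) (slope-t*t t)) (x+x≡0 (f t))

        f-fixed-point : ∀ w → f w ≡ w → w ≡ 0# ⊎ w ≡ 1#
        f-fixed-point w fw≡w = idempotent w (fixed-gcd h m coprime (trans (sym (pow-2^≡frob h w)) fw≡w) (frob-m w))

        kernel : ∀ t → ¬ t ≡ 0# → ∀ z → L (slope t) z ≡ 0# → z ≡ 0# ⊎ z ≡ t
        kernel t t≢0 z Lz≡0 with inverse t t≢0
        ... | t⁻¹ , tt⁻¹≡1 = Sum.map (λ w≡0 → trans (sym tw≡z) (trans (cong (t *_) w≡0) (zeroʳ t)))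
                                     (λ w≡1 → trans (sym tw≡z) (trans (cong (t *_) w≡1) (*-identityʳ t)))
                                     (f-fixed-point w fw≡w)
          where
          -- z = t w, and L (slope t) z = f t (f w + w) with f t ≢ 0
          w : Carrier
          w = t⁻¹ * z
          tw≡z : t * w ≡ z
          tw≡z = trans (sym (*-assoc t t⁻¹ z)) (trans (cong (_* z) tt⁻¹≡1) (*-identityˡ z))
          fw≡w : f w ≡ w
          fw≡w = sum≡0⇒≡ (f w) w
            (Sum.fromInj₂ (λ ft≡0 → ⊥-elim (pow-nonzero t (2 ^ h) t≢0 ft≡0))
             (no-zero-divisors (f t) (f w + w) (trans (sym (L-scaling t w)) (trans (cong (L (slope t)) tw≡z) Lz≡0))))

        image-size : ∀ t → ¬ t ≡ 0# → count (image? (slope t)) ℕ.+ count (image? (slope t)) ≡ size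
        image-size t t≢0 = TwoToOne.image-size (L (slope t)) (L-+ (slope t)) t t≢0 (L-root t) (kernel t t≢0)

        -- f is onto: iterating it m′ more times (where m ≡ 1 + m′) inverts it
        f-surjective : ∀ {m′} → m ≡ ℕ.suc m′ → ∀ s → ∃ λ t → f t ≡ s
        f-surjective {m′} m≡1+m′ s = frob (m′ ℕ.* h) s , (begin
          f (frob (m′ ℕ.* h) s)         ≡⟨ pow-2^≡frob h _ ⟩
          frob h (frob (m′ ℕ.* h) s)    ≡⟨ sym (frob-∘ (m′ ℕ.* h) h s) ⟩
          frob (m′ ℕ.* h ℕ.+ h) s       ≡⟨ cong (λ n → frob n s) m′h+h≡hm ⟩
          frob (h ℕ.* m) s              ≡⟨ fixed-* h m (frob-m s) ⟩
          s                             ∎)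
          where
          m′h+h≡hm : m′ ℕ.* h ℕ.+ h ≡ h ℕ.* m
          m′h+h≡hm = trans (ℕₚ.+-comm (m′ ℕ.* h) h) (trans (cong (ℕ._* h) (sym m≡1+m′)) (ℕₚ.*-comm m h))

        module Design {m′ : ℕ} (m≡1+m′ : m ≡ ℕ.suc m′) (p : ℕ) (size≡4p : size ≡ (p ℕ.+ p) ℕ.+ (p ℕ.+ p)) where
          open HalfBlocks (p ℕ.+ p) size≡4p

          half-block : ∀ t → ¬ t ≡ 0# → ∀ c → card (B (slope t) c) ≡ p ℕ.+ p
          half-block t t≢0 c = trans (card-B (slope t) c) (double-injective (trans (image-size t t≢0) size≡4p))

          intersection-numbers : ∀ b c b′ c′ → card (B b c) ≡ p ℕ.+ p → card (B b′ c′) ≡ p ℕ.+ p →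
            ¬ SameSet (B b c) (B b′ c′) → interSize (B b c) (B b′ c′) ≡ 0 ⊎ interSize (B b c) (B b′ c′) ≡ p
          intersection-numbers b c b′ c′ #B #B′ B≢B′ =
            Sum.map₂ double-injective (block-intersection b c b′ c′ #B #B′ B≢B′)

          0∈B : ∀ b → 0# ∈ B b 0#
          0∈B b = image⇒B b 0# (subst (_∈ image b) (sym (+-identityʳ 0#)) (0∈image b))

          H₁? : Decidable (_∈ image 1#)
          H₁? = image? 1#

          1≢0 : ¬ 1# ≡ 0#
          1≢0 1≡0 = 0≢1 (sym 1≡0)

          #B₁ : ∀ c → card (B 1# c) ≡ p ℕ.+ p
          #B₁ c = subst (λ b → card (B b c) ≡ p ℕ.+ p) slope-one (half-block 1# 1≢0 c)

          #H₁ : count H₁? ≡ p ℕ.+ p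
          #H₁ = trans (sym (card-B 1# 0#)) (#B₁ 0#)

          p≢0 : ¬ p ≡ 0
          p≢0 p≡0 = size-nonzero (trans size≡4p (cong (λ n → (n ℕ.+ n) ℕ.+ (n ℕ.+ n)) p≡0))

          H₁ : HalfSubgroup
          H₁ = image-subgroup 1# #H₁

          -- an element outside H₁, which exists since H₁ is only half of the field
          outside-H₁ : ∃ λ y → ¬ y ∈ image 1#
          outside-H₁ = count-witness (¬? ∘ H₁?) λ #outside≡0 →
            p≢0 (ℕₚ.m+n≡0⇒m≡0 p (trans (sym (complement-count H₁)) #outside≡0))

          -- a non-zero element of H₁, which exists since H₁ has an even number p + p ≢ 1 of elements
          nonzero-in-H₁ : ∃ λ y → y ∈ image 1# × ¬ y ≡ 0#
          nonzero-in-H₁ = count-witness (λ y → H₁? y ×-dec ¬? (y ≟ 0#)) λ #nonzero≡0 →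
            ℕₚ.even≢odd p 0 (begin
              2 ℕ.* p        ≡⟨ cong (p ℕ.+_) (ℕₚ.+-identityʳ p) ⟩
              p ℕ.+ p        ≡⟨ sym #H₁ ⟩
              count H₁?      ≡⟨ count-split H₁? (_≟ 0#) ⟩
              count (λ y → H₁? y ×-dec (y ≟ 0#)) ℕ.+ count (λ y → H₁? y ×-dec ¬? (y ≟ 0#))
                             ≡⟨ cong₂ ℕ._+_ (trans (count-cong _ (_≟ 0#) (proj₂ , λ { refl → 0∈image 1# , refl }))
                                                   (count-single 0#)) #nonzero≡0 ⟩
              1              ∎)

          y₀ : Carrier
          y₀ = proj₁ outside-H₁

          y₀∉H₁ : ¬ y₀ ∈ image 1#
          y₀∉H₁ = proj₂ outside-H₁

          -- B(1, 0) and B(1, y₀) are disjoint translates of H₁.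
          disjoint-pair : Σ[ b ∈ Carrier ] Σ[ c ∈ Carrier ] Σ[ b′ ∈ Carrier ] Σ[ c′ ∈ Carrier ]
            (card (B b c) ≡ p ℕ.+ p × card (B b′ c′) ≡ p ℕ.+ p × ¬ SameSet (B b c) (B b′ c′)
             × interSize (B b c) (B b′ c′) ≡ 0)
          disjoint-pair = 1# , 0# , 1# , y₀ , #B₁ 0# , #B₁ y₀ , distinct , count-none _ disjoint
            where
            distinct : ¬ SameSet (B 1# 0#) (B 1# y₀)
            distinct same = y₀∉H₁ (subst (_∈ image 1#) (+-identityˡ y₀) (B⇒image 1# y₀ (proj₁ (same 0#) (0∈B 1#))))
            disjoint : ∀ x → ¬ (x ∈ B 1# 0# × x ∈ B 1# y₀)
            disjoint x (x∈ , x∈′) = y₀∉H₁ (subst (_∈ image 1#) (x+[x+u]≡u x y₀)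
              (image-+ 1# (subst (_∈ image 1#) (+-identityʳ x) (B⇒image 1# 0# x∈)) (B⇒image 1# y₀ x∈′)))

          -- A slope t whose image contains y₀: writing y₀ = s h₀ with h₀ = f x₀ + x₀ ∈ H₁
          -- non-zero, any t with f t = s gives L (slope t) (t x₀) = f t (f x₀ + x₀) = y₀.
          h₀ : Carrier
          h₀ = proj₁ nonzero-in-H₁

          h₀≢0 : ¬ h₀ ≡ 0#
          h₀≢0 = proj₂ (proj₂ nonzero-in-H₁)

          x₀ : Carrier
          x₀ = proj₁ (∈-map⁻ (L 1#) (proj₁ (proj₂ nonzero-in-H₁)))

          h₀≡fx₀+x₀ : h₀ ≡ f x₀ + x₀
          h₀≡fx₀+x₀ = trans (proj₂ (proj₂ (∈-map⁻ (L 1#) (proj₁ (proj₂ nonzero-in-H₁))))) (cong (f x₀ +_) (*-identityˡ x₀))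

          h₀⁻¹ : Carrier
          h₀⁻¹ = proj₁ (inverse h₀ h₀≢0)

          t : Carrier
          t = proj₁ (f-surjective m≡1+m′ (y₀ * h₀⁻¹))

          ft≡y₀h₀⁻¹ : f t ≡ y₀ * h₀⁻¹
          ft≡y₀h₀⁻¹ = proj₂ (f-surjective m≡1+m′ (y₀ * h₀⁻¹))

          t≢0 : ¬ t ≡ 0#
          t≢0 t≡0 = y₀∉H₁ (subst (_∈ image 1#) (sym y₀≡0) (0∈image 1#))
            where
            y₀≡0 : y₀ ≡ 0#
            y₀≡0 = begin
              y₀                   ≡⟨ sym (*-identityʳ y₀) ⟩
              y₀ * 1#              ≡⟨ cong (y₀ *_) (sym (trans (*-comm h₀⁻¹ h₀) (proj₂ (inverse h₀ h₀≢0)))) ⟩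
              y₀ * (h₀⁻¹ * h₀)     ≡⟨ sym (*-assoc y₀ h₀⁻¹ h₀) ⟩
              (y₀ * h₀⁻¹) * h₀     ≡⟨ cong (_* h₀) (sym ft≡y₀h₀⁻¹) ⟩
              f t * h₀             ≡⟨ cong (λ z → f z * h₀) t≡0 ⟩
              f 0# * h₀            ≡⟨ cong (_* h₀) (trans (sym (slope-t*t 0#)) (zeroʳ (slope 0#))) ⟩
              0# * h₀              ≡⟨ zeroˡ h₀ ⟩
              0#                   ∎

          y₀∈image : y₀ ∈ image (slope t)
          y₀∈image = subst (_∈ image (slope t)) L[tx₀]≡y₀ (∈-image (slope t) (t * x₀))
            where
            L[tx₀]≡y₀ : L (slope t) (t * x₀) ≡ y₀
            L[tx₀]≡y₀ = begin
              L (slope t) (t * x₀)     ≡⟨ L-scaling t x₀ ⟩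
              f t * (f x₀ + x₀)        ≡⟨ cong₂ _*_ ft≡y₀h₀⁻¹ (sym h₀≡fx₀+x₀) ⟩
              (y₀ * h₀⁻¹) * h₀         ≡⟨ *-assoc y₀ h₀⁻¹ h₀ ⟩
              y₀ * (h₀⁻¹ * h₀)         ≡⟨ cong (y₀ *_) (trans (*-comm h₀⁻¹ h₀) (proj₂ (inverse h₀ h₀≢0))) ⟩
              y₀ * 1#                  ≡⟨ *-identityʳ y₀ ⟩
              y₀                       ∎

          -- B(1, 0) and B(slope t, 0) both contain 0 and differ at y₀, so they meet in p points.
          quarter-pair : Σ[ b ∈ Carrier ] Σ[ c ∈ Carrier ] Σ[ b′ ∈ Carrier ] Σ[ c′ ∈ Carrier ]
            (card (B b c) ≡ p ℕ.+ p × card (B b′ c′) ≡ p ℕ.+ p × ¬ SameSet (B b c) (B b′ c′)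
             × interSize (B b c) (B b′ c′) ≡ p)
          quarter-pair = 1# , 0# , slope t , 0# , #B₁ 0# , half-block t t≢0 0# , distinct ,
            Sum.fromInj₂ (λ #meet≡0 → ⊥-elim (count-zero _ #meet≡0 0# (0∈B 1# , 0∈B (slope t))))
              (intersection-numbers 1# 0# (slope t) 0# (#B₁ 0#) (half-block t t≢0 0#) distinct)
            where
            y₀∈B : y₀ ∈ B (slope t) 0#
            y₀∈B = image⇒B (slope t) 0# (subst (_∈ image (slope t)) (sym (+-identityʳ y₀)) y₀∈image)
            distinct : ¬ SameSet (B 1# 0#) (B (slope t) 0#)
            distinct same = y₀∉H₁ (subst (_∈ image 1#) (+-identityʳ y₀) (B⇒image 1# 0# (proj₂ (same y₀) y₀∈B)))

mainTheorem14 :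
    (m h : ℕ) → 2 ≤ m → 1 ≤ h → gcd h m ≡ 1 →
    (F : FiniteField) → FiniteField.size F ≡ 2 ^ m →
    let open FF F
        f : Carrier → Carrier
        f x = pow x (2 ^ h)
        B = block f
        k = 2 ^ m / 2
    in ((b c b′ c′ : Carrier) → card (B b c) ≡ k → card (B b′ c′) ≡ k →
          ¬ SameSet (B b c) (B b′ c′) →
          (interSize (B b c) (B b′ c′) ≡ 0) ⊎ (interSize (B b c) (B b′ c′) ≡ 2 ^ m / 4))
       × (Σ[ b ∈ Carrier ] Σ[ c ∈ Carrier ] Σ[ b′ ∈ Carrier ] Σ[ c′ ∈ Carrier ]
            (card (B b c) ≡ k × card (B b′ c′) ≡ k × ¬ SameSet (B b c) (B b′ c′)
             × interSize (B b c) (B b′ c′) ≡ 0))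
       × (Σ[ b ∈ Carrier ] Σ[ c ∈ Carrier ] Σ[ b′ ∈ Carrier ] Σ[ c′ ∈ Carrier ]
            (card (B b c) ≡ k × card (B b′ c′) ≡ k × ¬ SameSet (B b c) (B b′ c′)
             × interSize (B b c) (B b′ c′) ≡ 2 ^ m / 4))
-- With m = 2 + n and p = 2 ^ n we have q / 2 = p + p and q / 4 = p; the three
-- parts are the corresponding statements of the module Design.
mainTheorem14 (ℕ.suc (ℕ.suc n)) h (ℕ.s≤s (ℕ.s≤s _)) _ coprime F size≡2^m
  rewrite half-of-2^[2+n] n | quarter-of-2^[2+n] n =
  intersection-numbers , disjoint-pair , quarter-pair
  where
  open FF F
  open FieldTheory F
  open CharacteristicTwo (characteristic-two (2 ℕ.* 2 ^ n) size≡2^m)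
  frob-m : ∀ z → Fixed (2 ℕ.+ n) z
  frob-m z = trans (sym (pow-2^≡frob (2 ℕ.+ n) z)) (trans (cong (pow z) (sym size≡2^m)) (fermat z))
  open Blocks h
  open Slopes (2 ℕ.+ n) frob-m coprime
  open Design refl (2 ^ n) (trans size≡2^m (2^[2+n]≡4p n))
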